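{- Let $S$ be a sequence in $\mathbb Z_3$. Then $S$ is an $E$-extremal sequence for $(\mathbb Z_3',\{1\})$ if and only if $S$ is a translate of a sequence which is equivalent to the sequence $(1,1,0,0)$.
   Context: $\mathbb Z_3=\mathbb Z/3\mathbb Z$ as a module over itself and $\mathbb Z_3'=\mathbb Z_3\setminus\{0\}$. A subsequence is a non-empty subfamily of terms in the original order. For non-empty $A,B\subseteq\mathbb Z_n$, a sequence $(x_1,\ldots,x_k)$ is an $(A,B)$-weighted zero-sum sequence if there exist $a_i\in A$, $b_i\in B$ with $\sum a_ix_i=0$ and $\sum b_ia_i=0$. $E_{A,B}(n)$ is the least positive $k$ such that every sequence of length $k$ in $\mathbb Z_n$ has an $(A,B)$-weighted zero-sum subsequence of length $n$; an $E$-extremal sequence for $(A,B)$ is a sequence of length $E_{A,B}(n)-1$ with no such subsequence of length $n$. A translate of $(x_1,\ldots,x_k)$ is $(x_1+x,\ldots,x_k+x)$ for some $x$. Sequences $(x_1,\ldots,x_k)$, $(y_1,\ldots,y_k)$ are equivalent if there exist a permutation $\sigma$ of $[1,k]$ and a unit $u$ with $y_{\sigma(i)}=ux_i$ for all $i$. -}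

module Defs where

open import Data.Nat using (ℕ; zero; suc; _+_; _*_; _<_; NonZero)
open import Data.Nat.DivMod using (_mod_)
open import Data.Nat.Divisibility using (_∣_)
open import Data.Fin using (Fin; toℕ)
open import Data.List using (List; []; _∷_; length; map; zipWith)
open import Data.Nat.ListAction using (sum)
open import Data.List.Relation.Unary.All using (All)
open import Data.List.Relation.Binary.Sublist.Propositional using (_⊆_)
open import Data.List.Relation.Binary.Permutation.Propositional using (_↭_)
open import Data.Product using (∃; _×_)
open import Relation.Binary.PropositionalEquality using (_≡_; _≢_)
open import Relation.Nullary using (¬_)

-- Z_n is represented by Fin n (residues 0..n-1); arithmetic is mod n.

WSet : ℕ → Set₁
WSet n = Fin n → Set

addMod : (n : ℕ) → {{_ : NonZero n}} → Fin n → Fin n → Fin n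
addMod n a b = (toℕ a + toℕ b) mod n

mulMod : (n : ℕ) → {{_ : NonZero n}} → Fin n → Fin n → Fin n
mulMod n a b = (toℕ a * toℕ b) mod n

-- Σ a_i x_i computed in ℕ (then reduced mod n via divisibility)
dot : ∀ {n} → List (Fin n) → List (Fin n) → ℕ
dot as xs = sum (zipWith (λ a x → toℕ a * toℕ x) as xs)

WeightedZeroSum : (n : ℕ) → WSet n → WSet n → List (Fin n) → Set
WeightedZeroSum n A B xs =
  ∃ λ (as : List (Fin n)) → ∃ λ (bs : List (Fin n)) →
    length as ≡ length xs × length bs ≡ length xs ×
    All A as × All B bs ×
    n ∣ dot as xs × n ∣ dot bs as

HasWZSSubseq : (n : ℕ) → WSet n → WSet n → List (Fin n) → Set
HasWZSSubseq n A B xs =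
  ∃ λ (ys : List (Fin n)) → ys ⊆ xs × length ys ≡ n × WeightedZeroSum n A B ys

Forces : (n : ℕ) → WSet n → WSet n → ℕ → Set
Forces n A B k = ∀ (xs : List (Fin n)) → length xs ≡ k → HasWZSSubseq n A B xs

IsE : (n : ℕ) → WSet n → WSet n → ℕ → Set
IsE n A B k = 0 < k × Forces n A B k × (∀ j → 0 < j → j < k → ¬ Forces n A B j)

EExtremal : (n : ℕ) → WSet n → WSet n → List (Fin n) → Set
EExtremal n A B S = ∃ λ k → IsE n A B k × suc (length S) ≡ k × ¬ HasWZSSubseq n A B S

IsUnit : (n : ℕ) → {{_ : NonZero n}} → Fin n → Set
IsUnit n u = ∃ λ (v : Fin n) → mulMod n u v ≡ (1 mod n)

Translate : (n : ℕ) → {{_ : NonZero n}} → List (Fin n) → List (Fin n) → Set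
Translate n ys xs = ∃ λ (x : Fin n) → ys ≡ map (λ t → addMod n t x) xs

Equivalent : (n : ℕ) → {{_ : NonZero n}} → List (Fin n) → List (Fin n) → Set
Equivalent n xs ys = ∃ λ (u : Fin n) → IsUnit n u × ys ↭ map (mulMod n u) xs

Z3' : WSet 3
Z3' x = x ≢ Fin.zero

One3 : WSet 3
One3 x = x ≡ Fin.suc Fin.zero

s1100 : List (Fin 3)
s1100 = Fin.suc Fin.zero ∷ Fin.suc Fin.zero ∷ Fin.zero ∷ Fin.zero ∷ []

module Submission where

-- With B = {1} the weights a₁, a₂, a₃ ∈ {1, 2} of a length-3 subsequence must sum to 0 mod 3,
-- which forces them to be equal; as a common unit weight can be cancelled, a weighted
-- zero-sum subsequence of length 3 is just a subsequence whose sum is divisible by 3.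
-- Hence E(3) = 5 as in Erdős–Ginzburg–Ziv, the extremal sequences are the length-4 sequences
-- without such a subsequence, and up to a translation and a unit these are the rearrangements
-- of (1,1,0,0). The remaining claims are finitely many cases over ℤ₃, decided by enumeration;
-- rearrangement is decided by comparing insertion sorts.

open import Defs
open import Data.Fin using (Fin; toℕ)
open import Data.Nat using (ℕ)
open import Data.List using (List)
open import Data.Product using (∃; _×_)
open import Function.Bundles using (_⇔_)

open import Level using (Level)
open import Data.Nat using (zero; suc; _+_; _*_; _≤_; _≟_; s≤s; z<s)
open import Data.Nat.Properties
  using (<-cmp; m≤n⇒m⊓n≡m; *-zeroʳ; *-distribˡ-+; *-identityˡ; suc-injective)
open import Data.Nat.Divisibility using (_∣_; _∣?_; ∣-refl; >⇒∤)
open import Data.Nat.Primality using (Prime; prime?; euclidsLemma)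
open import Data.Nat.ListAction using (sum)
import Data.Fin as Fin
open import Data.Fin.Properties using (toℕ<n; ≤-decTotalOrder; ≤-totalOrder)
  renaming (any? to anyFin?; all? to allFin?; _≟_ to _≟ᶠ_)
open import Data.List using ([]; _∷_; [_]; _++_; map; length; take; replicate; allFin; cartesianProductWith)
open import Data.List.Properties using (length-take; length-map; map-∘; map-id; map-cong; ≡-dec)
open import Data.List.Membership.Propositional using (_∈_; find; lose)
open import Data.List.Membership.Propositional.Properties
  using (∈-++⁺ˡ; ∈-++⁺ʳ; ∈-++⁻; ∈-map⁺; ∈-map⁻; ∈-allFin; ∈-cartesianProductWith⁺)
open import Data.List.Relation.Unary.All as All using (All; []; _∷_; all?)
open import Data.List.Relation.Unary.Any using (here; any?)
open import Data.List.Relation.Binary.Sublist.Propositional using (_⊆_; []; _∷_; _∷ʳ_; ⊆-trans)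
open import Data.List.Relation.Binary.Sublist.Propositional.Properties using (take-⊆)
open import Data.List.Relation.Binary.Permutation.Propositional
  using (_↭_; ↭-sym; ↭-trans; ↭⇒↭ₛ; ↭-reflexive)
open import Data.List.Relation.Binary.Permutation.Propositional.Properties using (↭-length)
open import Data.List.Relation.Binary.Equality.Propositional using (≋⇒≡)
open import Data.List.Relation.Unary.Sorted.TotalOrder.Properties using (↗↭↗⇒≋)
import Data.List.Sort.InsertionSort as InsertionSort
import Data.List.Sort.InsertionSort.Properties as InsertionSortProperties
open import Data.Product using (_,_; proj₁; proj₂)
open import Data.Sum using (inj₁; inj₂)
open import Relation.Binary.PropositionalEquality
  using (_≡_; _≢_; refl; sym; trans; cong; subst; module ≡-Reasoning)
open import Relation.Binary.Definitions using (tri<; tri≈; tri>)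
import Relation.Binary.Definitions as Binary
open import Relation.Nullary using (¬_; contradiction)
open import Relation.Nullary.Decidable using (from-yes; from-no; map′; _×-dec_; _→-dec_; ¬?)
open import Relation.Unary using (Pred; Decidable)
open import Function.Bundles using (mk⇔; Equivalence)
import Function.Properties.Equivalence as ⇔

private
  variable
    a p : Level
    A : Set a

sublists : List A → List (List A)
sublists []       = [ [] ]
sublists (x ∷ xs) = map (x ∷_) (sublists xs) ++ sublists xs

∈-sublists⁺ : ∀ {xs ys : List A} → ys ⊆ xs → ys ∈ sublists xs
∈-sublists⁺ []                     = here refl
∈-sublists⁺ {xs = x ∷ xs} (x ∷ʳ τ) = ∈-++⁺ʳ (map (x ∷_) (sublists xs)) (∈-sublists⁺ τ)
∈-sublists⁺ (refl ∷ τ)             = ∈-++⁺ˡ (∈-map⁺ _ (∈-sublists⁺ τ))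

∈-sublists⁻ : ∀ (xs : List A) {ys} → ys ∈ sublists xs → ys ⊆ xs
∈-sublists⁻ []       (here refl) = []
∈-sublists⁻ (x ∷ xs) ys∈ with ∈-++⁻ (map (x ∷_) (sublists xs)) ys∈
... | inj₁ ys∈map with ∈-map⁻ (x ∷_) ys∈map
...   | zs , zs∈ , refl = refl ∷ ∈-sublists⁻ xs zs∈
∈-sublists⁻ (x ∷ xs) ys∈ | inj₂ ys∈rest = x ∷ʳ ∈-sublists⁻ xs ys∈rest

∃-sublist? : {P : Pred (List A) p} → Decidable P →
             Decidable (λ xs → ∃ λ ys → ys ⊆ xs × P ys)
∃-sublist? P? xs = map′
  (λ hit → let ys , ys∈ , pys = find hit in ys , ∈-sublists⁻ xs ys∈ , pys)
  (λ { (ys , τ , pys) → lose (∈-sublists⁺ τ) pys })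
  (any? P? (sublists xs))

listsOfLength : ∀ {k} → ℕ → List (List (Fin k))
listsOfLength zero    = [ [] ]
listsOfLength (suc n) = cartesianProductWith _∷_ (allFin _) (listsOfLength n)

∈-listsOfLength : ∀ {k} (xs : List (Fin k)) → xs ∈ listsOfLength (length xs)
∈-listsOfLength []       = here refl
∈-listsOfLength (x ∷ xs) = ∈-cartesianProductWith⁺ _∷_ (∈-allFin x) (∈-listsOfLength xs)

All-listsOfLength : ∀ {k n} {P : Pred (List (Fin k)) p} →
                    All P (listsOfLength n) → ∀ {xs} → length xs ≡ n → P xs
All-listsOfLength P-all {xs} refl = All.lookup P-all (∈-listsOfLength xs)

module _ {n : ℕ} where
  open InsertionSort (≤-decTotalOrder n) using (sort)
  open InsertionSortProperties (≤-decTotalOrder n) using (sort-↭; sort-↗)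

  ↭⇔sort≡ : ∀ {xs ys : List (Fin n)} → (xs ↭ ys) ⇔ (sort xs ≡ sort ys)
  ↭⇔sort≡ {xs} {ys} = mk⇔
    (λ xs↭ys → ≋⇒≡ (↗↭↗⇒≋ (≤-totalOrder n) (sort-↗ xs) (sort-↗ ys)
      (↭⇒↭ₛ (↭-trans (sort-↭ xs) (↭-trans xs↭ys (↭-sym (sort-↭ ys)))))))
    (λ eq → ↭-trans (↭-sym (sort-↭ xs)) (↭-trans (↭-reflexive eq) (sort-↭ ys)))

  _↭?_ : Binary.Decidable (_↭_ {A = Fin n})
  xs ↭? ys = map′ (Equivalence.from ↭⇔sort≡) (Equivalence.to ↭⇔sort≡)
    (≡-dec _≟ᶠ_ (sort xs) (sort ys))

module _ {n : ℕ} {A B : WSet n} where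

  HasWZSSubseq-⊆ : ∀ {xs ys} → xs ⊆ ys → HasWZSSubseq n A B xs → HasWZSSubseq n A B ys
  HasWZSSubseq-⊆ xs⊆ys (zs , zs⊆xs , zs-ok) = zs , ⊆-trans zs⊆xs xs⊆ys , zs-ok

  ¬Forces-≤ : ∀ {s j} → ¬ HasWZSSubseq n A B s → j ≤ length s → ¬ Forces n A B j
  ¬Forces-≤ {s} {j} ¬has j≤∣s∣ forces = ¬has (HasWZSSubseq-⊆ (take-⊆ j s)
    (forces (take j s) (trans (length-take j s) (m≤n⇒m⊓n≡m j≤∣s∣))))

  IsE-unique : ∀ {k l} → IsE n A B k → IsE n A B l → k ≡ l
  IsE-unique {k} {l} (0<k , forces-k , minimal-k) (0<l , forces-l , minimal-l) with <-cmp k l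
  ... | tri< k<l _ _ = contradiction forces-k (minimal-l _ 0<k k<l)
  ... | tri≈ _ k≡l _ = k≡l
  ... | tri> _ _ l<k = contradiction forces-l (minimal-k _ 0<l l<k)

  EExtremal⇔ : ∀ {k S} → IsE n A B k →
               EExtremal n A B S ⇔ (suc (length S) ≡ k × ¬ HasWZSSubseq n A B S)
  EExtremal⇔ isE = mk⇔
    (λ (l , isE-l , len , ¬has) → trans len (IsE-unique isE-l isE) , ¬has)
    (λ (len , ¬has) → _ , isE , len , ¬has)

sumFin : ∀ {k} → List (Fin k) → ℕ
sumFin xs = sum (map toℕ xs)

dot-const : ∀ {k} {c : Fin k} {ws xs : List (Fin k)} →
            All (_≡ c) ws → length ws ≡ length xs → dot ws xs ≡ toℕ c * sumFin xs
dot-const {c = c} {xs = []} [] _ = sym (*-zeroʳ (toℕ c))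
dot-const {c = c} {xs = x ∷ xs} (refl ∷ ws≡c) len = trans
  (cong (toℕ c * toℕ x +_) (dot-const ws≡c (suc-injective len)))
  (sym (*-distribˡ-+ (toℕ c) (toℕ x) (sumFin xs)))

nonzero-∤ : ∀ {n} (a : Fin (suc n)) → a ≢ Fin.zero → ¬ suc n ∣ toℕ a
nonzero-∤ Fin.zero    a≢0 = contradiction refl a≢0
nonzero-∤ (Fin.suc i) _   = >⇒∤ (toℕ<n (Fin.suc i))

prime-∣-nonzero*⇒∣ : ∀ {n s} → Prime (suc n) → (a : Fin (suc n)) → a ≢ Fin.zero →
                     suc n ∣ toℕ a * s → suc n ∣ s
prime-∣-nonzero*⇒∣ {s = s} p-prime a a≢0 p∣as with euclidsLemma (toℕ a) s p-prime p∣as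
... | inj₁ p∣a = contradiction p∣a (nonzero-∤ a a≢0)
... | inj₂ p∣s = p∣s

Z3'-weights-constant : ∀ {ws} → length ws ≡ 3 → All Z3' ws → 3 ∣ sumFin ws →
                       ∃ λ c → Z3' c × All (_≡ c) ws
Z3'-weights-constant = All-listsOfLength (from-yes (all? check (listsOfLength 3)))
  where
  nonzero? : Decidable Z3'
  nonzero? a = ¬? (a ≟ᶠ Fin.zero)
  check : Decidable (λ ws → All Z3' ws → 3 ∣ sumFin ws → ∃ λ c → Z3' c × All (_≡ c) ws)
  check ws = all? nonzero? ws →-dec (3 ∣? sumFin ws →-dec
             anyFin? (λ c → nonzero? c ×-dec all? (_≟ᶠ c) ws))

weightedZeroSum⇔3∣sumFin : ∀ {ys} → length ys ≡ 3 →
                           WeightedZeroSum 3 Z3' One3 ys ⇔ 3 ∣ sumFin ys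
weightedZeroSum⇔3∣sumFin {ys} ∣ys∣≡3 = mk⇔ to from
  where
  dot-ones : ∀ {ws} xs → All One3 ws → length ws ≡ length xs → dot ws xs ≡ sumFin xs
  dot-ones xs ws≡1 len = trans (dot-const ws≡1 len) (*-identityˡ (sumFin xs))

  to : WeightedZeroSum 3 Z3' One3 ys → 3 ∣ sumFin ys
  to (ws , bs , ∣ws∣ , ∣bs∣ , ws≢0 , bs≡1 , 3∣ws·ys , 3∣bs·ws) =
    let c , c≢0 , ws≡c = Z3'-weights-constant (trans ∣ws∣ ∣ys∣≡3) ws≢0
                           (subst (3 ∣_) (dot-ones ws bs≡1 (trans ∣bs∣ (sym ∣ws∣))) 3∣bs·ws)
    in prime-∣-nonzero*⇒∣ (from-yes (prime? 3)) c c≢0 (subst (3 ∣_) (dot-const ws≡c ∣ws∣) 3∣ws·ys)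

  ones : List (Fin 3)
  ones = replicate 3 (Fin.suc Fin.zero)

  ones≡1 : All One3 ones
  ones≡1 = refl ∷ refl ∷ refl ∷ []

  from : 3 ∣ sumFin ys → WeightedZeroSum 3 Z3' One3 ys
  from 3∣sum = ones , ones , sym ∣ys∣≡3 , sym ∣ys∣≡3 , (λ ()) ∷ (λ ()) ∷ (λ ()) ∷ [] , ones≡1 ,
    subst (3 ∣_) (sym (dot-ones ys ones≡1 (sym ∣ys∣≡3))) 3∣sum , ∣-refl

HasWZSSubseq₃ : List (Fin 3) → Set
HasWZSSubseq₃ = HasWZSSubseq 3 Z3' One3

ZeroSumTriple : List (Fin 3) → Set
ZeroSumTriple ys = length ys ≡ 3 × 3 ∣ sumFin ys

HasWZSSubseq₃⇔ : ∀ {xs} → HasWZSSubseq₃ xs ⇔ (∃ λ ys → ys ⊆ xs × ZeroSumTriple ys)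
HasWZSSubseq₃⇔ = mk⇔
  (λ (ys , ys⊆xs , ∣ys∣ , wzs) →
     ys , ys⊆xs , ∣ys∣ , Equivalence.to (weightedZeroSum⇔3∣sumFin ∣ys∣) wzs)
  (λ (ys , ys⊆xs , ∣ys∣ , 3∣sum) →
     ys , ys⊆xs , ∣ys∣ , Equivalence.from (weightedZeroSum⇔3∣sumFin ∣ys∣) 3∣sum)

hasWZSSubseq₃? : Decidable HasWZSSubseq₃
hasWZSSubseq₃? xs = map′ (Equivalence.from HasWZSSubseq₃⇔) (Equivalence.to HasWZSSubseq₃⇔)
  (∃-sublist? (λ ys → (length ys ≟ 3) ×-dec (3 ∣? sumFin ys)) xs)

forces5 : Forces 3 Z3' One3 5
forces5 xs = All-listsOfLength (from-yes (all? hasWZSSubseq₃? (listsOfLength 5)))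

¬hasWZSSubseq₃-1100 : ¬ HasWZSSubseq₃ s1100
¬hasWZSSubseq₃-1100 = from-no (hasWZSSubseq₃? s1100)

isE5 : IsE 3 Z3' One3 5
isE5 = z<s , forces5 , λ { j _ (s≤s j≤4) → ¬Forces-≤ ¬hasWZSSubseq₃-1100 j≤4 }

map-cancel : ∀ {f g : A → A} → (∀ t → g (f t) ≡ t) → ∀ xs → map g (map f xs) ≡ xs
map-cancel g∘f≗id xs = trans (sym (map-∘ xs)) (trans (map-cong g∘f≗id xs) (map-id xs))

shift : Fin 3 → Fin 3 → Fin 3
shift x t = addMod 3 t x

shift-invertible : ∀ x → ∃ λ y → ∀ t → shift y (shift x t) ≡ t
shift-invertible = from-yes (allFin? λ x → anyFin? λ y → allFin? λ t → shift y (shift x t) ≟ᶠ t)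

TranslateOfEquivalent1100 : List (Fin 3) → Set
TranslateOfEquivalent1100 S = ∃ λ T → Translate 3 S T × Equivalent 3 T s1100

ShiftsTo1100 : List (Fin 3) → Set
ShiftsTo1100 S = ∃ λ y → ∃ λ u → IsUnit 3 u × s1100 ↭ map (mulMod 3 u) (map (shift y) S)

TranslateOfEquivalent1100⇔ShiftsTo1100 : ∀ {S} → TranslateOfEquivalent1100 S ⇔ ShiftsTo1100 S
TranslateOfEquivalent1100⇔ShiftsTo1100 = mk⇔
  (λ { (T , (x , refl) , u , u-unit , 1100↭uT) →
       let y , y∘x≗id = shift-invertible x
       in y , u , u-unit ,
          subst (λ T′ → s1100 ↭ map (mulMod 3 u) T′) (sym (map-cancel y∘x≗id T)) 1100↭uT })
  (λ { (y , u , u-unit , 1100↭uT) →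
       let x , x∘y≗id = shift-invertible y
       in _ , (x , sym (map-cancel x∘y≗id _)) , u , u-unit , 1100↭uT })

isUnit? : Decidable (IsUnit 3)
isUnit? u = anyFin? λ v → mulMod 3 u v ≟ᶠ _

shiftsTo1100? : Decidable ShiftsTo1100
shiftsTo1100? S = anyFin? λ y → anyFin? λ u →
  isUnit? u ×-dec (s1100 ↭? map (mulMod 3 u) (map (shift y) S))

ShiftsTo1100⇒length≡4 : ∀ {S} → ShiftsTo1100 S → length S ≡ 4
ShiftsTo1100⇒length≡4 {S} (y , u , _ , 1100↭uS) = begin
  length S                                     ≡⟨ length-map (shift y) S ⟨
  length (map (shift y) S)                     ≡⟨ length-map (mulMod 3 u) (map (shift y) S) ⟨
  length (map (mulMod 3 u) (map (shift y) S))  ≡⟨ ↭-length 1100↭uS ⟨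
  4                                            ∎
  where open ≡-Reasoning

extremal⇔ShiftsTo1100 : ∀ {S} → (suc (length S) ≡ 5 × ¬ HasWZSSubseq₃ S) ⇔ ShiftsTo1100 S
extremal⇔ShiftsTo1100 {S} = mk⇔
  (λ (∣S∣ , ¬has) → proj₁ (classify (suc-injective ∣S∣)) ¬has)
  (λ shifts → let ∣S∣ = ShiftsTo1100⇒length≡4 shifts
              in cong suc ∣S∣ , proj₂ (classify ∣S∣) shifts)
  where
  classify : length S ≡ 4 →
             (¬ HasWZSSubseq₃ S → ShiftsTo1100 S) × (ShiftsTo1100 S → ¬ HasWZSSubseq₃ S)
  classify = All-listsOfLength (from-yes (all? (λ T →
    (¬? (hasWZSSubseq₃? T) →-dec shiftsTo1100? T) ×-dec (shiftsTo1100? T →-dec ¬? (hasWZSSubseq₃? T)))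
    (listsOfLength 4)))

theorem12 : (S : List (Fin 3)) →
    EExtremal 3 Z3' One3 S ⇔ (∃ λ (T : List (Fin 3)) → Translate 3 S T × Equivalent 3 T s1100)
theorem12 S = ⇔.trans (EExtremal⇔ isE5)
  (⇔.trans extremal⇔ShiftsTo1100 (⇔.sym TranslateOfEquivalent1100⇔ShiftsTo1100))
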